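{- For integers $n\ge 2$ and $p\ge 1$, $\sigma_n(p)=\delta_{n-1}(p+1)$, where $$\sigma_n(p)=n!\sum_{k=1}^\infty\frac{H_k^{(p)}}{k(k+1)\cdots(k+n)},\qquad \delta_{n}(q)=n!\sum_{k=1}^\infty\frac{1}{k^q(k+1)\cdots(k+n)}.$$
   Context: $H_k^{(p)}=1+2^{ -p}+\dots+k^{ -p}$ are the generalized harmonic numbers. In $\delta_n(q)$ the product $(k+1)\cdots(k+n)$ is empty (equal to $1$) when $n=0$. -}

module Defs where

open import Data.Nat using (ℕ; zero; suc; _^_; _≤_; _!) renaming (_+_ to _+ℕ_; _*_ to _*ℕ_)
open import Data.Integer using (+_)
open import Data.Rational using (ℚ; 0ℚ; _/_; _+_; _*_; _-_; ∣_∣; _<_)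
open import Data.Product using (∃-syntax)

-- reciprocal of a natural number as a rational (only ever applied to positive numbers)
recip : ℕ → ℚ
recip zero    = 0ℚ
recip (suc m) = + 1 / suc m

ℕtoℚ : ℕ → ℚ
ℕtoℚ m = + m / 1

sumFrom1 : ℕ → (ℕ → ℚ) → ℚ
sumFrom1 zero    f = 0ℚ
sumFrom1 (suc M) f = sumFrom1 M f + f (suc M)

rising : ℕ → ℕ → ℕ
rising k zero    = 1
rising k (suc n) = rising k n *ℕ (k +ℕ suc n)

H : ℕ → ℕ → ℚ
H p k = sumFrom1 k (λ i → recip (i ^ p))

σPartial : ℕ → ℕ → ℕ → ℚ
σPartial n p M = ℕtoℚ (n !) * sumFrom1 M (λ k → H p k * recip (k *ℕ rising k n))

δPartial : ℕ → ℕ → ℕ → ℚ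
δPartial n q M = ℕtoℚ (n !) * sumFrom1 M (λ k → recip ((k ^ q) *ℕ rising k n))

-- a rational sequence is Cauchy (i.e. converges to a real number)
Cauchy : (ℕ → ℚ) → Set
Cauchy a = ∀ ε → 0ℚ < ε → ∃[ N ] ∀ M K → N ≤ M → N ≤ K → ∣ a M - a K ∣ < ε

-- two rational sequences have the same limit: their difference tends to 0
SameLimit : (ℕ → ℚ) → (ℕ → ℚ) → Set
SameLimit a b = ∀ ε → 0ℚ < ε → ∃[ N ] ∀ M → N ≤ M → ∣ a M - b M ∣ < ε

{-# OPTIONS --safe #-}
-- Write a_k = 1 / (k (k+1) ⋯ (k+m)). Then (m+1) / (k (k+1) ⋯ (k+m+1)) = a_k − a_{k+1}, so
-- summation by parts turns the M-th partial sum of σ_{m+1}(p) into the M-th partial sum of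
-- δ_m(p+1) minus the boundary term m! H_M^{(p)} a_{M+1}. For m ≥ 1 this boundary term is at most
-- m! / (M+1), and the terms of δ_m(p+1) are dominated by the telescoping 1/k − 1/(k+1); hence
-- both sequences are Cauchy at rate O(1/N) and their difference tends to 0.
module Submission where

open import Data.Nat using (ℕ; _≤_; _∸_; _+_)
open import Data.Product using (_×_)
open import Data.Nat using (zero; suc; _*_; _^_; _!; z≤n; s≤s; _≤′_; ≤′-reflexive; ≤′-step)
import Data.Nat as ℕ
import Data.Nat.Properties as ℕ
open import Data.Nat.Tactic.RingSolver using (solve-∀)
open import Data.Integer using (+_; -[1+_])
import Data.Integer as ℤ
import Data.Integer.Properties as ℤ
import Data.Integer.Tactic.RingSolver as ℤ
open import Data.Rational using (ℚ; 0ℚ; 1ℚ; ∣_∣; mkℚ; toℚᵘ)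
import Data.Rational as ℚ
import Data.Rational.Properties as ℚ
open import Data.Rational.Solver using (module +-*-Solver)
open import Data.Rational.Unnormalised using (ℚᵘ; mkℚᵘ; *≡*; *≤*; *<*)
import Data.Rational.Unnormalised as ℚᵘ
import Data.Rational.Unnormalised.Properties as ℚᵘ
open import Data.Product using (_,_; ∃-syntax)
open import Data.Sum using (inj₁; inj₂)
open import Relation.Binary.PropositionalEquality
open import Defs

-- Facts about ℕtoℚ and recip are proved on unnormalised representatives, where they become
-- integer cross-multiplication identities.
toℚᵘ-ℕtoℚ : ∀ m → toℚᵘ (ℕtoℚ m) ℚᵘ.≃ mkℚᵘ (+ m) 0
toℚᵘ-ℕtoℚ m = ℚ.toℚᵘ-fromℚᵘ (mkℚᵘ (+ m) 0)

toℚᵘ-recip : ∀ m → toℚᵘ (recip (suc m)) ℚᵘ.≃ mkℚᵘ (+ 1) m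
toℚᵘ-recip m = ℚ.toℚᵘ-fromℚᵘ (mkℚᵘ (+ 1) m)

module _ {x y : ℚ} {u v : ℚᵘ} (x≃u : toℚᵘ x ℚᵘ.≃ u) (y≃v : toℚᵘ y ℚᵘ.≃ v) where

  ≡-viaℚᵘ : u ℚᵘ.≃ v → x ≡ y
  ≡-viaℚᵘ u≃v = ℚ.toℚᵘ-injective (ℚᵘ.≃-trans x≃u (ℚᵘ.≃-trans u≃v (ℚᵘ.≃-sym y≃v)))

  ≤-viaℚᵘ : u ℚᵘ.≤ v → x ℚ.≤ y
  ≤-viaℚᵘ u≤v =
    ℚ.toℚᵘ-cancel-≤ (ℚᵘ.≤-respˡ-≃ (ℚᵘ.≃-sym x≃u) (ℚᵘ.≤-respʳ-≃ (ℚᵘ.≃-sym y≃v) u≤v))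

  <-viaℚᵘ : u ℚᵘ.< v → x ℚ.< y
  <-viaℚᵘ u<v =
    ℚ.toℚᵘ-cancel-< (ℚᵘ.<-respˡ-≃ (ℚᵘ.≃-sym x≃u) (ℚᵘ.<-respʳ-≃ (ℚᵘ.≃-sym y≃v) u<v))

  toℚᵘ-+-≃ : toℚᵘ (x ℚ.+ y) ℚᵘ.≃ u ℚᵘ.+ v
  toℚᵘ-+-≃ = ℚᵘ.≃-trans (ℚ.toℚᵘ-homo-+ x y) (ℚᵘ.+-cong x≃u y≃v)

  toℚᵘ-*-≃ : toℚᵘ (x ℚ.* y) ℚᵘ.≃ u ℚᵘ.* v
  toℚᵘ-*-≃ = ℚᵘ.≃-trans (ℚ.toℚᵘ-homo-* x y) (ℚᵘ.*-cong x≃u y≃v)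

ℕtoℚ-+ : ∀ m n → ℕtoℚ (m + n) ≡ ℕtoℚ m ℚ.+ ℕtoℚ n
ℕtoℚ-+ m n = ≡-viaℚᵘ (toℚᵘ-ℕtoℚ (m + n)) (toℚᵘ-+-≃ (toℚᵘ-ℕtoℚ m) (toℚᵘ-ℕtoℚ n))
  (*≡* (trans (cong (ℤ._* + 1) (ℤ.pos-+ m n)) (cross (+ m) (+ n))))
  where
  cross : ∀ a b → (a ℤ.+ b) ℤ.* + 1 ≡ (a ℤ.* + 1 ℤ.+ b ℤ.* + 1) ℤ.* + 1
  cross = ℤ.solve-∀

ℕtoℚ-* : ∀ m n → ℕtoℚ (m * n) ≡ ℕtoℚ m ℚ.* ℕtoℚ n
ℕtoℚ-* m n = ≡-viaℚᵘ (toℚᵘ-ℕtoℚ (m * n)) (toℚᵘ-*-≃ (toℚᵘ-ℕtoℚ m) (toℚᵘ-ℕtoℚ n))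
  (*≡* (cong (ℤ._* + 1) (ℤ.pos-* m n)))

recip-* : ∀ m n → recip (m * n) ≡ recip m ℚ.* recip n
recip-* zero    n       = sym (ℚ.*-zeroˡ (recip n))
recip-* (suc m) zero    = trans (cong recip (ℕ.*-zeroʳ m)) (sym (ℚ.*-zeroʳ (recip (suc m))))
recip-* (suc m) (suc n) =
  ≡-viaℚᵘ (toℚᵘ-recip (n + m * suc n)) (toℚᵘ-*-≃ (toℚᵘ-recip m) (toℚᵘ-recip n))
    (*≡* (trans (ℤ.*-identityˡ d) (sym (ℤ.*-identityˡ d))))
  where
  d : ℤ.ℤ
  d = + suc (n + m * suc n)

ℕtoℚ-*-recip : ∀ m → ℕtoℚ (suc m) ℚ.* recip (suc m) ≡ 1ℚ
ℕtoℚ-*-recip m = ≡-viaℚᵘ (toℚᵘ-*-≃ (toℚᵘ-ℕtoℚ (suc m)) (toℚᵘ-recip m)) ℚᵘ.≃-refl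
  (*≡* (trans (cross (+ suc m)) (cong (λ k → + 1 ℤ.* + k) (sym (ℕ.*-identityˡ (suc m))))))
  where
  cross : ∀ a → a ℤ.* + 1 ℤ.* + 1 ≡ + 1 ℤ.* a
  cross = ℤ.solve-∀

ℕtoℚ-mono-≤ : ∀ {m n} → m ≤ n → ℕtoℚ m ℚ.≤ ℕtoℚ n
ℕtoℚ-mono-≤ {m} {n} m≤n = ≤-viaℚᵘ (toℚᵘ-ℕtoℚ m) (toℚᵘ-ℕtoℚ n)
  (*≤* (ℤ.*-monoʳ-≤-nonNeg (+ 1) (ℤ.+≤+ m≤n)))

ℕtoℚ-nonNeg : ∀ m → 0ℚ ℚ.≤ ℕtoℚ m
ℕtoℚ-nonNeg m = ℕtoℚ-mono-≤ (z≤n {m})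

recip-antimono-≤ : ∀ {m n} → 1 ≤ m → m ≤ n → recip n ℚ.≤ recip m
recip-antimono-≤ {suc m} {suc n} _ m≤n = ≤-viaℚᵘ (toℚᵘ-recip n) (toℚᵘ-recip m)
  (*≤* (ℤ.*-monoˡ-≤-nonNeg (+ 1) (ℤ.+≤+ m≤n)))

recip-nonNeg : ∀ m → 0ℚ ℚ.≤ recip m
recip-nonNeg zero    = ℚ.≤-refl
recip-nonNeg (suc m) = ≤-viaℚᵘ ℚᵘ.≃-refl (toℚᵘ-recip m) (*≤* (ℤ.+≤+ z≤n))

recip≤1 : ∀ m → recip m ℚ.≤ 1ℚ
recip≤1 zero    = ℚ.<⇒≤ (ℚ.positive⁻¹ 1ℚ)
recip≤1 (suc m) = recip-antimono-≤ (s≤s z≤n) (s≤s (z≤n {m}))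

*-nonNeg : ∀ {x y} → 0ℚ ℚ.≤ x → 0ℚ ℚ.≤ y → 0ℚ ℚ.≤ x ℚ.* y
*-nonNeg {x} {y} 0≤x 0≤y =
  subst (ℚ._≤ x ℚ.* y) (ℚ.*-zeroˡ y) (ℚ.*-monoʳ-≤-nonNeg y {{ℚ.nonNegative 0≤y}} 0≤x)

*-monoˡ-≤ : ∀ {c x y} → 0ℚ ℚ.≤ c → x ℚ.≤ y → c ℚ.* x ℚ.≤ c ℚ.* y
*-monoˡ-≤ {c} 0≤c = ℚ.*-monoˡ-≤-nonNeg c {{ℚ.nonNegative 0≤c}}

*-monoʳ-≤ : ∀ {c x y} → 0ℚ ℚ.≤ c → x ℚ.≤ y → x ℚ.* c ℚ.≤ y ℚ.* c
*-monoʳ-≤ {c} 0≤c = ℚ.*-monoʳ-≤-nonNeg c {{ℚ.nonNegative 0≤c}}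

x≤y⇒0≤y-x : ∀ {x y} → x ℚ.≤ y → 0ℚ ℚ.≤ y ℚ.- x
x≤y⇒0≤y-x {x} {y} x≤y = subst (ℚ._≤ y ℚ.- x) (ℚ.+-inverseʳ x) (ℚ.+-monoˡ-≤ (ℚ.- x) x≤y)

∣c*x∣≤c*y : ∀ {c x y} → 0ℚ ℚ.≤ c → ∣ x ∣ ℚ.≤ y → ∣ c ℚ.* x ∣ ℚ.≤ c ℚ.* y
∣c*x∣≤c*y {c} {x} 0≤c ∣x∣≤y = subst (ℚ._≤ _) (sym ∣c*x∣≡c*∣x∣) (*-monoˡ-≤ 0≤c ∣x∣≤y)
  where
  ∣c*x∣≡c*∣x∣ : ∣ c ℚ.* x ∣ ≡ c ℚ.* ∣ x ∣
  ∣c*x∣≡c*∣x∣ = trans (ℚ.∣p*q∣≡∣p∣*∣q∣ c x) (cong (ℚ._* ∣ x ∣) (ℚ.0≤p⇒∣p∣≡p 0≤c))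

∣x-y∣≡∣y-x∣ : ∀ x y → ∣ x ℚ.- y ∣ ≡ ∣ y ℚ.- x ∣
∣x-y∣≡∣y-x∣ x y =
  trans (cong ∣_∣ (solve 2 (λ x y → x :- y := :- (y :- x)) refl x y)) (ℚ.∣-p∣≡∣p∣ (y ℚ.- x))
  where open +-*-Solver

∣x-y∣≤∣x-u∣+∣u-v∣+∣v-y∣ : ∀ x y u v →
  ∣ x ℚ.- y ∣ ℚ.≤ ∣ x ℚ.- u ∣ ℚ.+ (∣ u ℚ.- v ∣ ℚ.+ ∣ v ℚ.- y ∣)
∣x-y∣≤∣x-u∣+∣u-v∣+∣v-y∣ x y u v = begin
  ∣ x ℚ.- y ∣
    ≡⟨ cong ∣_∣ (solve 4 (λ x y u v → x :- y := (x :- u) :+ ((u :- v) :+ (v :- y))) refl x y u v) ⟩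
  ∣ (x ℚ.- u) ℚ.+ ((u ℚ.- v) ℚ.+ (v ℚ.- y)) ∣
    ≤⟨ ℚ.∣p+q∣≤∣p∣+∣q∣ (x ℚ.- u) ((u ℚ.- v) ℚ.+ (v ℚ.- y)) ⟩
  ∣ x ℚ.- u ∣ ℚ.+ ∣ (u ℚ.- v) ℚ.+ (v ℚ.- y) ∣
    ≤⟨ ℚ.+-monoʳ-≤ ∣ x ℚ.- u ∣ (ℚ.∣p+q∣≤∣p∣+∣q∣ (u ℚ.- v) (v ℚ.- y)) ⟩
  ∣ x ℚ.- u ∣ ℚ.+ (∣ u ℚ.- v ∣ ℚ.+ ∣ v ℚ.- y ∣)
    ∎
  where
  open ℚ.≤-Reasoning
  open +-*-Solver

-- For ε = (u+1)/(d+1) the witness N = C (d+1) gives C/(N+1) < 1/(d+1) ≤ ε.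
archimedean : ∀ C ε → 0ℚ ℚ.< ε → ∃[ N ] ℕtoℚ C ℚ.* recip (suc N) ℚ.< ε
archimedean C (mkℚ (+ zero) d _) (ℚ.*<* (ℤ.+<+ ()))
archimedean C (mkℚ -[1+ u ] d _) (ℚ.*<* ())
archimedean C (mkℚ (+ suc u) d _) _ =
  N , <-viaℚᵘ (toℚᵘ-*-≃ (toℚᵘ-ℕtoℚ C) (toℚᵘ-recip N)) ℚᵘ.≃-refl (*<* cross)
  where
  N : ℕ
  N = C * suc d
  N<[1+u][1+N] : N ℕ.< suc u * (1 * suc N)
  N<[1+u][1+N] =
    ℕ.≤-trans (ℕ.≤-reflexive (sym (ℕ.*-identityˡ (suc N)))) (ℕ.m≤n*m (1 * suc N) (suc u))
  cross : (+ C ℤ.* + 1) ℤ.* + suc d ℤ.< + suc u ℤ.* + (1 * suc N)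
  cross = subst₂ ℤ._<_
    (trans (ℤ.pos-* C (suc d)) (cong (ℤ._* + suc d) (sym (ℤ.*-identityʳ (+ C)))))
    (sym (ℤ.pos-* (suc u) (1 * suc N)))
    (ℤ.+<+ N<[1+u][1+N])

sumFrom1-cong : ∀ M {f g : ℕ → ℚ} → (∀ k → f (suc k) ≡ g (suc k)) → sumFrom1 M f ≡ sumFrom1 M g
sumFrom1-cong zero    f≗g = refl
sumFrom1-cong (suc M) f≗g = cong₂ ℚ._+_ (sumFrom1-cong M f≗g) (f≗g M)

sumFrom1-*ˡ : ∀ M c (f : ℕ → ℚ) → sumFrom1 M (λ k → c ℚ.* f k) ≡ c ℚ.* sumFrom1 M f
sumFrom1-*ˡ zero    c f = sym (ℚ.*-zeroʳ c)
sumFrom1-*ˡ (suc M) c f = trans (cong (ℚ._+ c ℚ.* f (suc M)) (sumFrom1-*ˡ M c f))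
  (sym (ℚ.*-distribˡ-+ c (sumFrom1 M f) (f (suc M))))

sumFrom1-nonNeg : ∀ M {f} → (∀ k → 0ℚ ℚ.≤ f (suc k)) → 0ℚ ℚ.≤ sumFrom1 M f
sumFrom1-nonNeg zero    f≥0 = ℚ.≤-refl
sumFrom1-nonNeg (suc M) f≥0 = ℚ.+-mono-≤ (sumFrom1-nonNeg M f≥0) (f≥0 M)

sumFrom1-≤-length : ∀ M {f} → (∀ k → f (suc k) ℚ.≤ 1ℚ) → sumFrom1 M f ℚ.≤ ℕtoℚ M
sumFrom1-≤-length zero        f≤1 = ℚ.≤-refl
sumFrom1-≤-length (suc M) {f} f≤1 =
  subst (sumFrom1 (suc M) f ℚ.≤_) (trans (ℚ.+-comm (ℕtoℚ M) 1ℚ) (sym (ℕtoℚ-+ 1 M)))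
    (ℚ.+-mono-≤ (sumFrom1-≤-length M f≤1) (f≤1 M))

sumFrom1-mono : ∀ {M K f} → (∀ k → 0ℚ ℚ.≤ f (suc k)) → M ≤′ K → sumFrom1 M f ℚ.≤ sumFrom1 K f
sumFrom1-mono f≥0 (≤′-reflexive refl) = ℚ.≤-refl
sumFrom1-mono {f = f} f≥0 (≤′-step {K} M≤K) = ℚ.≤-trans (sumFrom1-mono f≥0 M≤K)
  (subst (ℚ._≤ sumFrom1 (suc K) f) (ℚ.+-identityʳ (sumFrom1 K f))
    (ℚ.+-monoʳ-≤ (sumFrom1 K f) (f≥0 K)))

sumFrom1-by-parts : ∀ M (r A : ℕ → ℚ) →
  sumFrom1 M (λ k → sumFrom1 k r ℚ.* (A k ℚ.- A (suc k))) ≡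
  sumFrom1 M (λ k → A k ℚ.* r k) ℚ.- sumFrom1 M r ℚ.* A (suc M)
sumFrom1-by-parts zero    r A = solve 1 (λ a → con 0ℚ := con 0ℚ :- con 0ℚ :* a) refl (A 1)
  where open +-*-Solver
sumFrom1-by-parts (suc M) r A = begin
  sumFrom1 M (λ k → sumFrom1 k r ℚ.* (A k ℚ.- A (suc k))) ℚ.+ (R ℚ.+ ρ) ℚ.* (α ℚ.- β)
    ≡⟨ cong (ℚ._+ (R ℚ.+ ρ) ℚ.* (α ℚ.- β)) (sumFrom1-by-parts M r A) ⟩
  (S ℚ.- R ℚ.* α) ℚ.+ (R ℚ.+ ρ) ℚ.* (α ℚ.- β)
    ≡⟨ solve 5 (λ S R ρ α β → (S :- R :* α) :+ (R :+ ρ) :* (α :- β) := (S :+ α :* ρ) :- (R :+ ρ) :* β)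
         refl S R ρ α β ⟩
  (S ℚ.+ α ℚ.* ρ) ℚ.- (R ℚ.+ ρ) ℚ.* β
    ∎
  where
  open ≡-Reasoning
  open +-*-Solver
  S R ρ α β : ℚ
  S = sumFrom1 M (λ k → A k ℚ.* r k)
  R = sumFrom1 M r
  ρ = r (suc M)
  α = A (suc M)
  β = A (suc (suc M))

-- The partial sums S M increase while S M + g (M+1) decreases, so every later partial sum is
-- trapped in an interval of length g (N+1).
module TelescopingBound (f g : ℕ → ℚ)
  (f≥0 : ∀ k → 0ℚ ℚ.≤ f (suc k))
  (f≤g-g : ∀ k → f (suc k) ℚ.≤ g (suc k) ℚ.- g (suc (suc k)))
  (g≥0 : ∀ k → 0ℚ ℚ.≤ g (suc k))
  where

  S : ℕ → ℚ
  S M = sumFrom1 M f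

  S+g-antitone : ∀ {M K} → M ≤′ K → S K ℚ.+ g (suc K) ℚ.≤ S M ℚ.+ g (suc M)
  S+g-antitone (≤′-reflexive refl) = ℚ.≤-refl
  S+g-antitone (≤′-step {K} M≤K)   = ℚ.≤-trans one-step (S+g-antitone M≤K)
    where
    open +-*-Solver
    one-step : S K ℚ.+ f (suc K) ℚ.+ g (suc (suc K)) ℚ.≤ S K ℚ.+ g (suc K)
    one-step = subst (S K ℚ.+ f (suc K) ℚ.+ g (suc (suc K)) ℚ.≤_)
      (solve 3 (λ s x y → s :+ (x :- y) :+ y := s :+ x) refl (S K) (g (suc K)) (g (suc (suc K))))
      (ℚ.+-monoˡ-≤ (g (suc (suc K))) (ℚ.+-monoʳ-≤ (S K) (f≤g-g K)))

  ∣S-S∣≤-ordered : ∀ {N M K} → N ≤ M → M ≤ K → ∣ S K ℚ.- S M ∣ ℚ.≤ g (suc N)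
  ∣S-S∣≤-ordered {N} {M} {K} N≤M M≤K = begin
    ∣ S K ℚ.- S M ∣            ≡⟨ ℚ.0≤p⇒∣p∣≡p (x≤y⇒0≤y-x (sumFrom1-mono f≥0 (ℕ.≤⇒≤′ M≤K))) ⟩
    S K ℚ.- S M                ≤⟨ ℚ.+-mono-≤ SK≤SN+g (ℚ.neg-antimono-≤ (sumFrom1-mono f≥0 (ℕ.≤⇒≤′ N≤M))) ⟩
    S N ℚ.+ g (suc N) ℚ.- S N  ≡⟨ solve 2 (λ s t → s :+ t :- s := t) refl (S N) (g (suc N)) ⟩
    g (suc N)                  ∎
    where
    open ℚ.≤-Reasoning
    open +-*-Solver
    SK≤SN+g : S K ℚ.≤ S N ℚ.+ g (suc N)
    SK≤SN+g = ℚ.≤-trans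
      (subst (ℚ._≤ S K ℚ.+ g (suc K)) (ℚ.+-identityʳ (S K)) (ℚ.+-monoʳ-≤ (S K) (g≥0 K)))
      (S+g-antitone (ℕ.≤⇒≤′ (ℕ.≤-trans N≤M M≤K)))

  ∣sumFrom1-sumFrom1∣≤ : ∀ {N M K} → N ≤ M → N ≤ K → ∣ S M ℚ.- S K ∣ ℚ.≤ g (suc N)
  ∣sumFrom1-sumFrom1∣≤ {N} {M} {K} N≤M N≤K with ℕ.≤-total M K
  ... | inj₁ M≤K = subst (ℚ._≤ g (suc N)) (∣x-y∣≡∣y-x∣ (S K) (S M)) (∣S-S∣≤-ordered N≤M M≤K)
  ... | inj₂ K≤M = ∣S-S∣≤-ordered N≤K K≤M

record CauchyRate (C : ℕ) (a : ℕ → ℚ) : Set where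
  constructor cauchyRate
  field
    ∣a-a∣≤ : ∀ {N M K} → N ≤ M → N ≤ K → ∣ a M ℚ.- a K ∣ ℚ.≤ ℕtoℚ C ℚ.* recip (suc N)

record DistanceRate (C : ℕ) (a b : ℕ → ℚ) : Set where
  constructor distanceRate
  field
    ∣a-b∣≤ : ∀ {N M} → N ≤ M → ∣ a M ℚ.- b M ∣ ℚ.≤ ℕtoℚ C ℚ.* recip (suc N)

CauchyRate⇒Cauchy : ∀ {C a} → CauchyRate C a → Cauchy a
CauchyRate⇒Cauchy {C} (cauchyRate ∣a-a∣≤) ε ε>0 with archimedean C ε ε>0
... | N , bound<ε = N , λ M K N≤M N≤K → ℚ.≤-<-trans (∣a-a∣≤ N≤M N≤K) bound<ε

DistanceRate⇒SameLimit : ∀ {C a b} → DistanceRate C a b → SameLimit a b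
DistanceRate⇒SameLimit {C} (distanceRate ∣a-b∣≤) ε ε>0 with archimedean C ε ε>0
... | N , bound<ε = N , λ M N≤M → ℚ.≤-<-trans (∣a-b∣≤ N≤M) bound<ε

CauchyRate-*ˡ : ∀ {C a} D → CauchyRate C a → CauchyRate (D * C) (λ M → ℕtoℚ D ℚ.* a M)
CauchyRate-*ˡ {C} {a} D (cauchyRate ∣a-a∣≤) = cauchyRate bound
  where
  d : ℚ
  d = ℕtoℚ D
  bound : ∀ {N M K} → N ≤ M → N ≤ K →
    ∣ d ℚ.* a M ℚ.- d ℚ.* a K ∣ ℚ.≤ ℕtoℚ (D * C) ℚ.* recip (suc N)
  bound {N} {M} {K} N≤M N≤K = begin
    ∣ d ℚ.* a M ℚ.- d ℚ.* a K ∣  ≡⟨ cong ∣_∣ (solve 3 (λ d x y → d :* x :- d :* y := d :* (x :- y))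
                                                refl d (a M) (a K)) ⟩
    ∣ d ℚ.* (a M ℚ.- a K) ∣      ≤⟨ ∣c*x∣≤c*y (ℕtoℚ-nonNeg D) (∣a-a∣≤ N≤M N≤K) ⟩
    d ℚ.* (ℕtoℚ C ℚ.* r)         ≡⟨ ℚ.*-assoc d (ℕtoℚ C) r ⟨
    d ℚ.* ℕtoℚ C ℚ.* r           ≡⟨ cong (ℚ._* r) (ℕtoℚ-* D C) ⟨
    ℕtoℚ (D * C) ℚ.* r           ∎
    where
    open ℚ.≤-Reasoning
    open +-*-Solver
    r : ℚ
    r = recip (suc N)

CauchyRate-close : ∀ {C D a b} → CauchyRate C a → DistanceRate D b a → CauchyRate (D + (C + D)) b
CauchyRate-close {C} {D} {a} {b} (cauchyRate ∣a-a∣≤) (distanceRate ∣b-a∣≤) = cauchyRate bound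
  where
  c d : ℚ
  c = ℕtoℚ C
  d = ℕtoℚ D
  bound : ∀ {N M K} → N ≤ M → N ≤ K → ∣ b M ℚ.- b K ∣ ℚ.≤ ℕtoℚ (D + (C + D)) ℚ.* recip (suc N)
  bound {N} {M} {K} N≤M N≤K = begin
    ∣ b M ℚ.- b K ∣
      ≤⟨ ∣x-y∣≤∣x-u∣+∣u-v∣+∣v-y∣ (b M) (b K) (a M) (a K) ⟩
    ∣ b M ℚ.- a M ∣ ℚ.+ (∣ a M ℚ.- a K ∣ ℚ.+ ∣ a K ℚ.- b K ∣)
      ≤⟨ ℚ.+-mono-≤ (∣b-a∣≤ N≤M) (ℚ.+-mono-≤ (∣a-a∣≤ N≤M N≤K)
           (subst (ℚ._≤ d ℚ.* r) (∣x-y∣≡∣y-x∣ (b K) (a K)) (∣b-a∣≤ N≤K))) ⟩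
    d ℚ.* r ℚ.+ (c ℚ.* r ℚ.+ d ℚ.* r)
      ≡⟨ solve 3 (λ c d r → d :* r :+ (c :* r :+ d :* r) := (d :+ (c :+ d)) :* r) refl c d r ⟩
    (d ℚ.+ (c ℚ.+ d)) ℚ.* r
      ≡⟨ cong (ℚ._* r) (trans (ℕtoℚ-+ D (C + D)) (cong (d ℚ.+_) (ℕtoℚ-+ C D))) ⟨
    ℕtoℚ (D + (C + D)) ℚ.* r
      ∎
    where
    open ℚ.≤-Reasoning
    open +-*-Solver
    r : ℚ
    r = recip (suc N)

rising-mono-≤ : ∀ k {m n} → m ≤′ n → rising k m ≤ rising k n
rising-mono-≤ k (≤′-reflexive refl) = ℕ.≤-refl
rising-mono-≤ k (≤′-step {n} m≤n)   = ℕ.≤-trans (rising-mono-≤ k m≤n)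
  (subst (λ j → rising k n ≤ rising k n * j) (sym (ℕ.+-suc k n)) (ℕ.m≤m*n (rising k n) (suc (k + n))))

rising-positive : ∀ k m → 1 ≤ rising k m
rising-positive k m = rising-mono-≤ k (ℕ.z≤′n {m})

suc-≤-rising : ∀ k m → suc k ≤ rising k (suc m)
suc-≤-rising k m = ℕ.≤-trans (ℕ.≤-reflexive (trans (ℕ.+-comm 1 k) (sym (ℕ.*-identityˡ (k + 1)))))
  (rising-mono-≤ k (ℕ.s≤′s (ℕ.z≤′n {m})))

*-rising-suc : ∀ k m → suc k * rising (suc k) m ≡ rising k (suc m)
*-rising-suc k zero    =
  trans (ℕ.*-identityʳ (suc k)) (trans (ℕ.+-comm 1 k) (sym (ℕ.*-identityˡ (k + 1))))
*-rising-suc k (suc m) = begin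
  suc k * (rising (suc k) m * (suc k + suc m)) ≡⟨ ℕ.*-assoc (suc k) (rising (suc k) m) (suc k + suc m) ⟨
  suc k * rising (suc k) m * (suc k + suc m)   ≡⟨ cong₂ _*_ (*-rising-suc k m) (sym (ℕ.+-suc k (suc m))) ⟩
  rising k (suc m) * (k + suc (suc m))         ∎
  where open ≡-Reasoning

recipRising : ℕ → ℕ → ℚ
recipRising m k = recip (k * rising k m)

partialFraction : ∀ n k x y z → k ℚ.* x ≡ 1ℚ → (k ℚ.+ n) ℚ.* z ≡ 1ℚ →
  n ℚ.* (x ℚ.* (y ℚ.* z)) ≡ x ℚ.* y ℚ.- y ℚ.* z
partialFraction n k x y z kx≡1 [k+n]z≡1 = begin
  n ℚ.* (x ℚ.* (y ℚ.* z))
    ≡⟨ solve 5 (λ n k x y z → n :* (x :* (y :* z)) := x :* y :* ((k :+ n) :* z) :- y :* z :* (k :* x))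
         refl n k x y z ⟩
  x ℚ.* y ℚ.* ((k ℚ.+ n) ℚ.* z) ℚ.- y ℚ.* z ℚ.* (k ℚ.* x)
    ≡⟨ cong₂ (λ a b → x ℚ.* y ℚ.* a ℚ.- y ℚ.* z ℚ.* b) [k+n]z≡1 kx≡1 ⟩
  x ℚ.* y ℚ.* 1ℚ ℚ.- y ℚ.* z ℚ.* 1ℚ
    ≡⟨ cong₂ ℚ._-_ (ℚ.*-identityʳ (x ℚ.* y)) (ℚ.*-identityʳ (y ℚ.* z)) ⟩
  x ℚ.* y ℚ.- y ℚ.* z
    ∎
  where
  open ≡-Reasoning
  open +-*-Solver

recipRising-telescope : ∀ m k →
  ℕtoℚ (suc m) ℚ.* recip (suc k * rising (suc k) (suc m)) ≡
  recipRising m (suc k) ℚ.- recipRising m (suc (suc k))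
recipRising-telescope m k = begin
  ℕtoℚ (suc m) ℚ.* recip (suc k * (P * L))
    ≡⟨ cong (ℕtoℚ (suc m) ℚ.*_)
         (trans (recip-* (suc k) (P * L)) (cong (recip (suc k) ℚ.*_) (recip-* P L))) ⟩
  ℕtoℚ (suc m) ℚ.* (recip (suc k) ℚ.* (recip P ℚ.* recip L))
    ≡⟨ partialFraction (ℕtoℚ (suc m)) (ℕtoℚ (suc k)) (recip (suc k)) (recip P) (recip L)
         (ℕtoℚ-*-recip k)
         (trans (cong (ℚ._* recip L) (sym (ℕtoℚ-+ (suc k) (suc m)))) (ℕtoℚ-*-recip (k + suc m))) ⟩
  recip (suc k) ℚ.* recip P ℚ.- recip P ℚ.* recip L
    ≡⟨ cong₂ ℚ._-_ (sym (recip-* (suc k) P))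
         (sym (trans (cong recip (*-rising-suc (suc k) m)) (recip-* P L))) ⟩
  recipRising m (suc k) ℚ.- recipRising m (suc (suc k))
    ∎
  where
  open ≡-Reasoning
  P L : ℕ
  P = rising (suc k) m
  L = suc k + suc m

recipRising-*-recip-^ : ∀ m p k → recipRising m k ℚ.* recip (k ^ p) ≡ recip (k ^ (p + 1) * rising k m)
recipRising-*-recip-^ m p k = trans (sym (recip-* (k * rising k m) (k ^ p))) (cong recip (begin
  k * rising k m * k ^ p        ≡⟨ rearrange k (rising k m) (k ^ p) ⟩
  k ^ p * (k * 1) * rising k m  ≡⟨ cong (_* rising k m) (ℕ.^-distribˡ-+-* k p 1) ⟨
  k ^ (p + 1) * rising k m      ∎))
  where
  open ≡-Reasoning
  rearrange : ∀ k r q → k * r * q ≡ q * (k * 1) * r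
  rearrange = solve-∀

harmonic-by-parts : ∀ m p M →
  ℕtoℚ (suc m) ℚ.* sumFrom1 M (λ k → H p k ℚ.* recip (k * rising k (suc m))) ≡
  sumFrom1 M (λ k → recip (k ^ (p + 1) * rising k m)) ℚ.- H p M ℚ.* recipRising m (suc M)
harmonic-by-parts m p M = begin
  N ℚ.* sumFrom1 M (λ k → H p k ℚ.* recip (k * rising k (suc m)))
    ≡⟨ sumFrom1-*ˡ M N (λ k → H p k ℚ.* recip (k * rising k (suc m))) ⟨
  sumFrom1 M (λ k → N ℚ.* (H p k ℚ.* recip (k * rising k (suc m))))
    ≡⟨ sumFrom1-cong M (λ k → trans (reorder (H p (suc k)) _)
         (cong (H p (suc k) ℚ.*_) (recipRising-telescope m k))) ⟩
  sumFrom1 M (λ k → H p k ℚ.* (recipRising m k ℚ.- recipRising m (suc k)))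
    ≡⟨ sumFrom1-by-parts M (λ i → recip (i ^ p)) (recipRising m) ⟩
  sumFrom1 M (λ k → recipRising m k ℚ.* recip (k ^ p)) ℚ.- H p M ℚ.* recipRising m (suc M)
    ≡⟨ cong (ℚ._- H p M ℚ.* recipRising m (suc M))
         (sumFrom1-cong M (λ k → recipRising-*-recip-^ m p (suc k))) ⟩
  sumFrom1 M (λ k → recip (k ^ (p + 1) * rising k m)) ℚ.- H p M ℚ.* recipRising m (suc M)
    ∎
  where
  open ≡-Reasoning
  N : ℚ
  N = ℕtoℚ (suc m)
  reorder : ∀ h t → N ℚ.* (h ℚ.* t) ≡ h ℚ.* (N ℚ.* t)
  reorder h t = trans (sym (ℚ.*-assoc N h t)) (trans (cong (ℚ._* t) (ℚ.*-comm N h)) (ℚ.*-assoc h N t))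

σPartial≡δPartial-tail : ∀ m p M →
  σPartial (suc m) p M ≡ δPartial m (p + 1) M ℚ.- ℕtoℚ (m !) ℚ.* (H p M ℚ.* recipRising m (suc M))
σPartial≡δPartial-tail m p M = begin
  ℕtoℚ (suc m * m !) ℚ.* S  ≡⟨ cong (ℚ._* S) (trans (ℕtoℚ-* (suc m) (m !)) (ℚ.*-comm N c)) ⟩
  c ℚ.* N ℚ.* S             ≡⟨ ℚ.*-assoc c N S ⟩
  c ℚ.* (N ℚ.* S)           ≡⟨ cong (c ℚ.*_) (harmonic-by-parts m p M) ⟩
  c ℚ.* (Δ ℚ.- E)           ≡⟨ solve 3 (λ c Δ E → c :* (Δ :- E) := c :* Δ :- c :* E) refl c Δ E ⟩
  c ℚ.* Δ ℚ.- c ℚ.* E       ∎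
  where
  open ≡-Reasoning
  open +-*-Solver
  N c S Δ E : ℚ
  N = ℕtoℚ (suc m)
  c = ℕtoℚ (m !)
  S = sumFrom1 M (λ k → H p k ℚ.* recip (k * rising k (suc m)))
  Δ = sumFrom1 M (λ k → recip (k ^ (p + 1) * rising k m))
  E = H p M ℚ.* recipRising m (suc M)

H-nonNeg : ∀ p M → 0ℚ ℚ.≤ H p M
H-nonNeg p M = sumFrom1-nonNeg M (λ k → recip-nonNeg (suc k ^ p))

H≤ : ∀ p M → H p M ℚ.≤ ℕtoℚ M
H≤ p M = sumFrom1-≤-length M (λ k → recip≤1 (suc k ^ p))

H-*-recipRising≤ : ∀ m p M → H p M ℚ.* recipRising (suc m) (suc M) ℚ.≤ recip (suc M)
H-*-recipRising≤ m p M = begin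
  H p M ℚ.* recip (suc M * R)
    ≤⟨ *-monoʳ-≤ (recip-nonNeg (suc M * R)) (ℚ.≤-trans (H≤ p M) (ℕtoℚ-mono-≤ (ℕ.n≤1+n M))) ⟩
  ℕtoℚ (suc M) ℚ.* recip (suc M * R)
    ≡⟨ cong (ℕtoℚ (suc M) ℚ.*_) (recip-* (suc M) R) ⟩
  ℕtoℚ (suc M) ℚ.* (recip (suc M) ℚ.* recip R)
    ≡⟨ ℚ.*-assoc (ℕtoℚ (suc M)) (recip (suc M)) (recip R) ⟨
  ℕtoℚ (suc M) ℚ.* recip (suc M) ℚ.* recip R
    ≡⟨ trans (cong (ℚ._* recip R) (ℕtoℚ-*-recip M)) (ℚ.*-identityˡ (recip R)) ⟩
  recip R
    ≤⟨ recip-antimono-≤ (s≤s z≤n) (ℕ.≤-trans (ℕ.n≤1+n (suc M)) (suc-≤-rising (suc M) m)) ⟩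
  recip (suc M)
    ∎
  where
  open ℚ.≤-Reasoning
  R : ℕ
  R = rising (suc M) (suc m)

δTerm≤telescope : ∀ m p k → recip (suc k ^ (p + 1) * rising (suc k) (suc m)) ℚ.≤
  recipRising 0 (suc k) ℚ.- recipRising 0 (suc (suc k))
δTerm≤telescope m p k = begin
  recip (suc k ^ (p + 1) * rising (suc k) (suc m))
    ≤⟨ recip-antimono-≤ (ℕ.*-mono-≤ (s≤s (z≤n {k})) (rising-positive (suc k) 1))
         (ℕ.*-mono-≤ k≤k^[p+1] (rising-mono-≤ (suc k) (ℕ.s≤′s (ℕ.z≤′n {m})))) ⟩
  recip (suc k * rising (suc k) 1)
    ≡⟨ ℚ.*-identityˡ (recip (suc k * rising (suc k) 1)) ⟨
  ℕtoℚ 1 ℚ.* recip (suc k * rising (suc k) 1)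
    ≡⟨ recipRising-telescope 0 k ⟩
  recipRising 0 (suc k) ℚ.- recipRising 0 (suc (suc k))
    ∎
  where
  open ℚ.≤-Reasoning
  k≤k^[p+1] : suc k ≤ suc k ^ (p + 1)
  k≤k^[p+1] = subst (suc k ≤_) (cong (suc k ^_) (ℕ.+-comm 1 p))
    (ℕ.m≤m*n (suc k) (suc k ^ p) {{ℕ.m^n≢0 (suc k) p}})

δSum-cauchyRate : ∀ m p → CauchyRate 1 (λ M → sumFrom1 M (λ k → recip (k ^ (p + 1) * rising k (suc m))))
δSum-cauchyRate m p = cauchyRate λ {N} N≤M N≤K →
  subst (ℚ._≤_ _) (trans (cong recip (ℕ.*-identityʳ (suc N))) (sym (ℚ.*-identityˡ (recip (suc N)))))
    (∣sumFrom1-sumFrom1∣≤ N≤M N≤K)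
  where
  δTerm : ℕ → ℚ
  δTerm k = recip (k ^ (p + 1) * rising k (suc m))
  open TelescopingBound δTerm (recipRising 0)
    (λ k → recip-nonNeg (suc k ^ (p + 1) * rising (suc k) (suc m)))
    (δTerm≤telescope m p)
    (λ k → recip-nonNeg (suc k * 1))

δPartial-cauchyRate : ∀ m p → CauchyRate (suc m ! * 1) (δPartial (suc m) (p + 1))
δPartial-cauchyRate m p = CauchyRate-*ˡ (suc m !) (δSum-cauchyRate m p)

σPartial-δPartial-distanceRate : ∀ m p →
  DistanceRate (suc m !) (σPartial (suc (suc m)) p) (δPartial (suc m) (p + 1))
σPartial-δPartial-distanceRate m p = distanceRate bound
  where
  c : ℚ
  c = ℕtoℚ (suc m !)
  bound : ∀ {N M} → N ≤ M →
    ∣ σPartial (suc (suc m)) p M ℚ.- δPartial (suc m) (p + 1) M ∣ ℚ.≤ c ℚ.* recip (suc N)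
  bound {N} {M} N≤M = begin
    ∣ σPartial (suc (suc m)) p M ℚ.- δ ∣  ≡⟨ cong (λ σ → ∣ σ ℚ.- δ ∣) (σPartial≡δPartial-tail (suc m) p M) ⟩
    ∣ δ ℚ.- c ℚ.* E ℚ.- δ ∣              ≡⟨ cong ∣_∣ (solve 2 (λ δ x → δ :- x :- δ := :- x) refl δ (c ℚ.* E)) ⟩
    ∣ ℚ.- (c ℚ.* E) ∣                    ≡⟨ ℚ.∣-p∣≡∣p∣ (c ℚ.* E) ⟩
    ∣ c ℚ.* E ∣                          ≤⟨ ∣c*x∣≤c*y (ℕtoℚ-nonNeg (suc m !)) ∣E∣≤1/[N+1] ⟩
    c ℚ.* recip (suc N)                  ∎
    where
    open ℚ.≤-Reasoning
    open +-*-Solver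
    δ E : ℚ
    δ = δPartial (suc m) (p + 1) M
    E = H p M ℚ.* recipRising (suc m) (suc M)
    ∣E∣≤1/[N+1] : ∣ E ∣ ℚ.≤ recip (suc N)
    ∣E∣≤1/[N+1] = subst (ℚ._≤ recip (suc N))
      (sym (ℚ.0≤p⇒∣p∣≡p (*-nonNeg (H-nonNeg p M) (recip-nonNeg (suc M * rising (suc M) (suc m))))))
      (ℚ.≤-trans (H-*-recipRising≤ m p M) (recip-antimono-≤ (s≤s z≤n) (s≤s N≤M)))

mainTheorem5 : (n p : ℕ) → 2 ≤ n → 1 ≤ p →
    Cauchy (σPartial n p) × Cauchy (δPartial (n ∸ 1) (p + 1)) ×
    SameLimit (σPartial n p) (δPartial (n ∸ 1) (p + 1))
mainTheorem5 (suc (suc m)) p (s≤s (s≤s z≤n)) _ =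
    CauchyRate⇒Cauchy (CauchyRate-close δ-rate σδ-rate)
  , CauchyRate⇒Cauchy δ-rate
  , DistanceRate⇒SameLimit σδ-rate
  where
  δ-rate : CauchyRate (suc m ! * 1) (δPartial (suc m) (p + 1))
  δ-rate = δPartial-cauchyRate m p
  σδ-rate : DistanceRate (suc m !) (σPartial (suc (suc m)) p) (δPartial (suc m) (p + 1))
  σδ-rate = σPartial-δPartial-distanceRate m p
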